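{- Let $n,k$ be positive integers and let $p$ be a prime. Then (a) $a_{1,k}(n)=c_{k+1}(n-k)$, and (b) $a_{p,k}(n)=\bar c_{k,p}(n-p-k+1)$.
   Context: A partition of $n$ is a weakly decreasing finite sequence of positive integers summing to $n$; $\mathcal P(n)$ is the set of partitions of $n$ (the empty partition is the unique partition of $0$, and there are no partitions of negative integers). For a partition $\lambda$ and positive integer $i$, $m_\lambda(i)$ is the number of parts of $\lambda$ equal to $i$. For a partition $\lambda=(\lambda_1,\ldots,\lambda_\ell)$ with $\ell\ge k$, $\mathrm{pre}_k(\lambda)$ is the partition whose parts are the $\binom{\ell}{k}$ products $\lambda_{i_1}\cdots\lambda_{i_k}$ over all $1\le i_1<\cdots<i_k\le\ell$ (with multiplicity); it is undefined if $\ell<k$. $\mathrm{pre}_k(\mathcal P(n))$ denotes the set of partitions $\mathrm{pre}_k(\lambda)$ for $\lambda\in\mathcal P(n)$ with at least $k$ parts, and $a_{i,k}(n)=\sum_{\nu\in \mathrm{pre}_k(\mathcal P(n))} m_\nu(i)$ is the total number of parts equal to $i$ among these partitions. $c_k(n)$ is the number of partitions of $n$ in which the part $1$ may occur in $k$ distinct colors and all other parts are uncolored (two such partitions are the same iff they have the same number of parts of each uncolored value and of each colored $1$). $\bar c_{k,p}(n)$ is the number of partitions of $n$ in which the part $1$ may occur in $k$ distinct colors, the part $p$ may occur in $2$ distinct colors, and all other parts are uncolored. Both counts are $0$ for negative $n$. -}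

module Defs where

open import Data.Nat using (ℕ; zero; suc; _≤ᵇ_; _≡ᵇ_; _<ᵇ_)
open import Data.Bool using (Bool; true; false; _∧_; _∨_; if_then_else_)
open import Data.List using (List; []; _∷_; map; concatMap; filterᵇ; length; upTo; _++_)
open import Data.Nat.ListAction using (sum; product)
open import Data.Bool.ListAction using (all)
open import Data.Product using (_×_; _,_; proj₁)
open import Data.Integer using (ℤ; +_; -[1+_])

listsOf : {A : Set} → ℕ → List A → List (List A)
listsOf zero    xs = [] ∷ []
listsOf (suc l) xs = concatMap (λ x → map (x ∷_) (listsOf l xs)) xs

listsUpToLen : {A : Set} → ℕ → List A → List (List A)
listsUpToLen n xs = concatMap (λ l → listsOf l xs) (upTo (suc n))

range1 : ℕ → List ℕ
range1 n = map suc (upTo n)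

weaklyDecreasing : List ℕ → Bool
weaklyDecreasing []           = true
weaklyDecreasing (x ∷ [])     = true
weaklyDecreasing (x ∷ y ∷ ys) = (y ≤ᵇ x) ∧ weaklyDecreasing (y ∷ ys)

isPartitionᵇ : ℕ → List ℕ → Bool
isPartitionᵇ n λ′ = weaklyDecreasing λ′ ∧ all (1 ≤ᵇ_) λ′ ∧ (sum λ′ ≡ᵇ n)

-- 𝒫(n): every partition of n has at most n parts, each in [1..n], so
-- filtering all such lists enumerates 𝒫(n) exactly once each.
𝒫 : ℕ → List (List ℕ)
𝒫 n = filterᵇ (isPartitionᵇ n) (listsUpToLen n (range1 n))

mult : List ℕ → ℕ → ℕ
mult λ′ i = length (filterᵇ (_≡ᵇ i) λ′)

-- all C(ℓ,k) choices of k positions i₁ < ... < i_k (as sub-lists, with multiplicity)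
choose : ℕ → List ℕ → List (List ℕ)
choose zero    xs       = [] ∷ []
choose (suc k) []       = []
choose (suc k) (x ∷ xs) = map (x ∷_) (choose k xs) ++ choose (suc k) xs

-- pre_k(λ) (as a multiset of parts; order is irrelevant for multiplicities)
pre : ℕ → List ℕ → List ℕ
pre k λ′ = map product (choose k λ′)

preP : ℕ → ℕ → List (List ℕ)
preP k n = map (pre k) (filterᵇ (λ λ′ → k ≤ᵇ length λ′) (𝒫 n))

a : ℕ → ℕ → ℕ → ℕ
a i k n = sum (map (λ ν → mult ν i) (preP k n))

-- A part is (value , colour); `cols v` is the
-- number of colours available to value v (colours 0 .. cols v - 1).
-- A coloured partition is listed canonically in weakly decreasing
-- lexicographic order, so two are equal iff they have the same
-- multiplicity of every (value, colour).

colouredParts : (ℕ → ℕ) → ℕ → List (ℕ × ℕ)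
colouredParts cols n = concatMap (λ v → map (v ,_) (upTo (cols v))) (range1 n)

lexGeq : ℕ × ℕ → ℕ × ℕ → Bool
lexGeq (v₁ , c₁) (v₂ , c₂) = (v₂ <ᵇ v₁) ∨ ((v₁ ≡ᵇ v₂) ∧ (c₂ ≤ᵇ c₁))

lexDecreasing : List (ℕ × ℕ) → Bool
lexDecreasing []           = true
lexDecreasing (x ∷ [])     = true
lexDecreasing (x ∷ y ∷ ys) = lexGeq x y ∧ lexDecreasing (y ∷ ys)

colouredPartitions : (ℕ → ℕ) → ℕ → List (List (ℕ × ℕ))
colouredPartitions cols n =
  filterᵇ (λ μ → lexDecreasing μ ∧ (sum (map proj₁ μ) ≡ᵇ n))
          (listsUpToLen n (colouredParts cols n))

countℤ : (ℕ → ℕ) → ℤ → ℕ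
countℤ cols (+ n)      = length (colouredPartitions cols n)
countℤ cols -[1+ n ]   = 0

c : ℕ → ℤ → ℕ
c k = countℤ (λ v → if v ≡ᵇ 1 then k else 1)

-- c̄_{k,p} : part 1 in k colours, part p in 2 colours, others uncoloured
-- (used with p prime, so p ≠ 1)
cbar : ℕ → ℕ → ℤ → ℕ
cbar k p = countℤ (λ v → if v ≡ᵇ 1 then k else (if v ≡ᵇ p then 2 else 1))

-- A product of k parts is 1 only if all factors are 1, and a prime p only if one factor is p
-- and the others are 1; hence a_{1,k}(n) = Σ_λ C(m_λ(1), k) and
-- a_{p,k}(n) = Σ_λ m_λ(p) C(m_λ(1), k-1), summed over λ ∈ 𝒫(n).
-- In the generating function Π_v 1/(1-q^v) of partitions, the weight C(m,k) on the parts 1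
-- replaces 1/(1-q) by q^k/(1-q)^(k+1), and the weight m on the parts p replaces 1/(1-q^p)
-- by q^p/(1-q^p)²: these are q^k, resp. q^(p+k-1), times the factors of the coloured parts
-- counted by c_{k+1}, resp. c̄_{k,p}.  Series are handled as coefficient sequences, where
-- F = F′/(1-q^v) is the recurrence F(n) = F′(n) + F(n-v), whose solution is unique; the
-- brute-force enumerations of (coloured) partitions are matched, up to permutation, with a
-- recursive generator of multisets of parts whose weighted counts satisfy these recurrences
-- one part at a time.

module Submission where

open import Defs
open import Data.Bool using (Bool; true; false; if_then_else_; T; _∧_)
open import Data.Bool.ListAction using (all)
open import Data.Bool.Properties using (T-≡; T-∧; T-∨)
import Data.Integer as ℤ
open import Data.Integer.Properties using (m-n≡m⊖n; ⊖-≥; ⊖-<)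
open import Data.Integer.Tactic.RingSolver using (solve-∀)
open import Data.List
  using (List; []; _∷_; [_]; map; concatMap; filterᵇ; length; upTo; replicate; _++_; cartesianProductWith)
open import Data.List.Properties
  using (∷-injective; ++-identityʳ; map-++; map-∘; map-id; map-cong; map-replicate; length-++;
         filter-++; filter-accept; filter-reject; concatMap-cong; concatMap-map; concatMap-pure; map-concatMap)
open import Data.List.Membership.Propositional using (_∈_; find; lose)
open import Data.List.Membership.Propositional.Properties
  using (∈-filter⁺; ∈-filter⁻; ∈-++⁺ˡ; ∈-++⁺ʳ; ∈-++⁻; ∈-concatMap⁺; ∈-concatMap⁻;
         ∈-cartesianProductWith⁺; ∈-cartesianProductWith⁻; ∈-map⁺; ∈-map⁻; ∈-upTo⁺; ∈-upTo⁻)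
open import Data.List.Membership.Propositional.Properties.WithK using (unique∧set⇒bag)
open import Data.List.Relation.Binary.BagAndSetEquality using (∼bag⇒↭)
open import Data.List.Relation.Binary.Permutation.Propositional using (_↭_)
import Data.List.Relation.Binary.Permutation.Propositional.Properties as ↭
open import Data.List.Relation.Unary.All as All using (All; []; _∷_)
import Data.List.Relation.Unary.All.Properties as All
open import Data.List.Relation.Unary.AllPairs as AllPairs using (AllPairs; []; _∷_)
import Data.List.Relation.Unary.AllPairs.Properties as AllPairs
open import Data.List.Relation.Unary.Any using (here; there)
open import Data.List.Relation.Unary.Unique.Propositional using (Unique)
import Data.List.Relation.Unary.Unique.Propositional.Properties as Unique
open import Data.Nat
open import Data.Nat.Combinatorics using (_C_; nCk+nC[k+1]≡[n+1]C[k+1])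
open import Data.Nat.Divisibility using (divides)
open import Data.Nat.Induction using (<-rec)
open import Data.Nat.ListAction using (sum; product)
open import Data.Nat.ListAction.Properties using (sum-++; sum-↭)
open import Data.Nat.Primality using (Prime; prime⇒nonTrivial; prime⇒nonZero; prime⇒irreducible)
open import Data.Nat.Properties
open import Algebra.Properties.CommutativeSemigroup +-commutativeSemigroup using (interchange)
open import Data.Product using (_×_; _,_; proj₁; proj₂)
open import Data.Product.Properties using (,-injectiveʳ)
open import Data.Sum using (_⊎_; inj₁; inj₂; [_,_]′)
open import Function using (_∘_; Equivalence; mk⇔)
open import Relation.Binary.PropositionalEquality
  using (_≡_; _≢_; _≗_; refl; sym; trans; cong; cong₂; subst; module ≡-Reasoning)
open import Relation.Nullary using (¬_; yes; no; contradiction)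
open import Relation.Nullary.Decidable using (T?)

≤ᵇ-true : ∀ {m n} → m ≤ n → (m ≤ᵇ n) ≡ true
≤ᵇ-true = Equivalence.to T-≡ ∘ ≤⇒≤ᵇ

≤ᵇ-false : ∀ {m n} → n < m → (m ≤ᵇ n) ≡ false
≤ᵇ-false {m} {n} n<m with m ≤ᵇ n in eq
... | false = refl
... | true  = contradiction (≤ᵇ⇒≤ m n (Equivalence.from T-≡ eq)) (<⇒≱ n<m)

≢⇒≡ᵇ-false : ∀ {m n} → m ≢ n → (m ≡ᵇ n) ≡ false
≢⇒≡ᵇ-false {m} {n} m≢n with m ≡ᵇ n in eq
... | false = refl
... | true  = contradiction (≡ᵇ⇒≡ m n (Equivalence.from T-≡ eq)) m≢n

-- shift d F is q^d · F; it is opaque so that F and d can be inferred from shift d F n.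
opaque
  shift : ℕ → (ℕ → ℕ) → ℕ → ℕ
  shift d F n = if d ≤ᵇ n then F (n ∸ d) else 0

-- F = F′ / (1 - q^v), in the form F = F′ + q^v · F.
_≗_/[1-q^_] : (ℕ → ℕ) → (ℕ → ℕ) → ℕ → Set
F ≗ F′ /[1-q^ v ] = ∀ n → F n ≡ F′ n + shift v F n

opaque
  unfolding shift

  shift-≤ : ∀ {F d n} → d ≤ n → shift d F n ≡ F (n ∸ d)
  shift-≤ d≤n rewrite ≤ᵇ-true d≤n = refl

  shift-< : ∀ {F d n} → n < d → shift d F n ≡ 0
  shift-< n<d rewrite ≤ᵇ-false n<d = refl

module _ {F G : ℕ → ℕ} where

  shift-cong : ∀ {d n} → (d ≤ n → F (n ∸ d) ≡ G (n ∸ d)) → shift d F n ≡ shift d G n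
  shift-cong {d} {n} eq with d ≤? n
  ... | yes d≤n = trans (shift-≤ d≤n) (trans (eq d≤n) (sym (shift-≤ d≤n)))
  ... | no d≰n  = trans (shift-< (≰⇒> d≰n)) (sym (shift-< (≰⇒> d≰n)))

  shift-+ : ∀ d n → shift d (λ m → F m + G m) n ≡ shift d F n + shift d G n
  shift-+ d n with d ≤? n
  ... | yes d≤n = trans (shift-≤ d≤n) (sym (cong₂ _+_ (shift-≤ d≤n) (shift-≤ d≤n)))
  ... | no d≰n  = let n<d = ≰⇒> d≰n in trans (shift-< n<d) (sym (cong₂ _+_ (shift-< n<d) (shift-< n<d)))

shift-shift : ∀ a b (F : ℕ → ℕ) n → shift a (shift b F) n ≡ shift (a + b) F n
shift-shift a b F n with a ≤? n
... | no a≰n = trans (shift-< (≰⇒> a≰n)) (sym (shift-< (<-≤-trans (≰⇒> a≰n) (m≤m+n a b))))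
... | yes a≤n with b ≤? n ∸ a
...   | yes b≤n∸a = begin
        shift a (shift b F) n  ≡⟨ shift-≤ a≤n ⟩
        shift b F (n ∸ a)      ≡⟨ shift-≤ b≤n∸a ⟩
        F (n ∸ a ∸ b)          ≡⟨ cong F (∸-+-assoc n a b) ⟩
        F (n ∸ (a + b))        ≡⟨ shift-≤ a+b≤n ⟨
        shift (a + b) F n      ∎
  where
  open ≡-Reasoning
  a+b≤n : a + b ≤ n
  a+b≤n = subst (a + b ≤_) (m+[n∸m]≡n a≤n) (+-monoʳ-≤ a b≤n∸a)
...   | no b≰n∸a = trans (shift-≤ a≤n) (trans (shift-< (≰⇒> b≰n∸a)) (sym (shift-< n<a+b)))
  where
  n<a+b : n < a + b
  n<a+b = subst (_< a + b) (m+[n∸m]≡n a≤n) (+-monoʳ-< a (≰⇒> b≰n∸a))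

module _ {F G H : ℕ → ℕ} {v : ℕ} where

  -- The recurrence determines F because q^v · F only involves earlier coefficients.
  /[1-q^]-unique : 1 ≤ v → F ≗ H /[1-q^ v ] → G ≗ H /[1-q^ v ] → F ≗ G
  /[1-q^]-unique 1≤v F≗ G≗ = <-rec (λ n → F n ≡ G n) step
    where
    step : ∀ n → (∀ {m} → m < n → F m ≡ G m) → F n ≡ G n
    step n ih = begin
      F n                  ≡⟨ F≗ n ⟩
      H n + shift v F n    ≡⟨ cong (H n +_) (shift-cong (λ v≤n → ih (∸-monoʳ-< 1≤v v≤n))) ⟩
      H n + shift v G n    ≡⟨ G≗ n ⟨
      G n                  ∎
      where open ≡-Reasoning

  /[1-q^]-resp : H ≗ G → F ≗ H /[1-q^ v ] → F ≗ G /[1-q^ v ]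
  /[1-q^]-resp H≗G F≗ n = trans (F≗ n) (cong (_+ shift v F n) (H≗G n))

shift-/[1-q^] : ∀ {G G′ v} d → G ≗ G′ /[1-q^ v ] → shift d G ≗ shift d G′ /[1-q^ v ]
shift-/[1-q^] {G} {G′} {v} d G≗ n = begin
  shift d G n                               ≡⟨ shift-cong (λ _ → G≗ (n ∸ d)) ⟩
  shift d (λ m → G′ m + shift v G m) n      ≡⟨ shift-+ d n ⟩
  shift d G′ n + shift d (shift v G) n      ≡⟨ cong (shift d G′ n +_) (shift-shift d v G n) ⟩
  shift d G′ n + shift (d + v) G n          ≡⟨ cong (λ e → shift d G′ n + shift e G n) (+-comm d v) ⟩
  shift d G′ n + shift (v + d) G n          ≡⟨ cong (shift d G′ n +_) (shift-shift v d G n) ⟨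
  shift d G′ n + shift v (shift d G) n      ∎
  where open ≡-Reasoning

-- Dividing both sides of F′ = q^d · G′ by 1 - q^v.
/[1-q^]-shift : ∀ {F F′ G G′ v} d → 1 ≤ v → F ≗ F′ /[1-q^ v ] → G ≗ G′ /[1-q^ v ] →
                F′ ≗ shift d G′ → F ≗ shift d G
/[1-q^]-shift {G = G} {G′} d 1≤v F≗ G≗ F′≗ =
  /[1-q^]-unique 1≤v (/[1-q^]-resp F′≗ F≗) (shift-/[1-q^] {G} {G′} d G≗)

concatMap-unique : ∀ {A B : Set} {f : A → List B} (key : B → A) →
                   (∀ {x y} → y ∈ f x → key y ≡ x) → (∀ x → Unique (f x)) →
                   ∀ {xs} → Unique xs → Unique (concatMap f xs)
concatMap-unique {f = f} key key-∈ f-unique xs-unique =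
  Unique.concat⁺ (All.map⁺ (All.universal f-unique _)) (AllPairs.map⁺ (AllPairs.map disjoint xs-unique))
  where
  disjoint : ∀ {x y} → x ≢ y → ∀ {z} → ¬ (z ∈ f x × z ∈ f y)
  disjoint x≢y (z∈fx , z∈fy) = x≢y (trans (sym (key-∈ z∈fx)) (key-∈ z∈fy))

module _ {A : Set} where

  listsOf-suc : ∀ l (xs : List A) → listsOf (suc l) xs ≡ cartesianProductWith _∷_ xs (listsOf l xs)
  listsOf-suc l xs = go xs
    where
    go : ∀ ys → concatMap (λ y → map (y ∷_) (listsOf l xs)) ys
              ≡ cartesianProductWith _∷_ ys (listsOf l xs)
    go []       = refl
    go (y ∷ ys) = cong (map (y ∷_) (listsOf l xs) ++_) (go ys)

  ∈-listsOf⁻ : ∀ l {xs ys : List A} → ys ∈ listsOf l xs → length ys ≡ l × All (_∈ xs) ys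
  ∈-listsOf⁻ zero    (here refl) = refl , []
  ∈-listsOf⁻ (suc l) {xs} ys∈ rewrite listsOf-suc l xs
    with y , zs , y∈xs , zs∈ , refl ← ∈-cartesianProductWith⁻ _∷_ xs (listsOf l xs) ys∈
    with length≡ , zs⊆ ← ∈-listsOf⁻ l zs∈ = cong suc length≡ , y∈xs ∷ zs⊆

  ∈-listsOf⁺ : ∀ {xs ys : List A} → All (_∈ xs) ys → ys ∈ listsOf (length ys) xs
  ∈-listsOf⁺                []          = here refl
  ∈-listsOf⁺ {xs} {_ ∷ ys} (y∈xs ∷ ys⊆) rewrite listsOf-suc (length ys) xs =
    ∈-cartesianProductWith⁺ _∷_ y∈xs (∈-listsOf⁺ ys⊆)

  listsOf-unique : ∀ l {xs : List A} → Unique xs → Unique (listsOf l xs)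
  listsOf-unique zero    _         = [] ∷ []
  listsOf-unique (suc l) {xs} xs-unique rewrite listsOf-suc l xs =
    Unique.cartesianProductWith⁺ _∷_ ∷-injective xs-unique (listsOf-unique l xs-unique)

  ∈-listsUpToLen⁻ : ∀ n {xs ys : List A} → ys ∈ listsUpToLen n xs → length ys ≤ n × All (_∈ xs) ys
  ∈-listsUpToLen⁻ n ys∈ with l , l∈ , ys∈ₗ ← find (∈-concatMap⁻ (λ l → listsOf l _) ys∈)
    with refl , ys⊆ ← ∈-listsOf⁻ l ys∈ₗ = ≤-pred (∈-upTo⁻ l∈) , ys⊆

  ∈-listsUpToLen⁺ : ∀ n {xs ys : List A} → length ys ≤ n → All (_∈ xs) ys → ys ∈ listsUpToLen n xs
  ∈-listsUpToLen⁺ n ys≤n ys⊆ =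
    ∈-concatMap⁺ (λ l → listsOf l _) (lose (∈-upTo⁺ (s≤s ys≤n)) (∈-listsOf⁺ ys⊆))

  listsUpToLen-unique : ∀ n {xs : List A} → Unique xs → Unique (listsUpToLen n xs)
  listsUpToLen-unique n xs-unique =
    concatMap-unique length (proj₁ ∘ ∈-listsOf⁻ _) (λ l → listsOf-unique l xs-unique)
      (Unique.upTo⁺ (suc n))

∈-range1⁻ : ∀ {n v} → v ∈ range1 n → 1 ≤ v × v ≤ n
∈-range1⁻ v∈ with _ , u∈ , refl ← ∈-map⁻ suc v∈ = s≤s z≤n , ∈-upTo⁻ u∈

∈-range1⁺ : ∀ {n v} → 1 ≤ v → v ≤ n → v ∈ range1 n
∈-range1⁺ (s≤s z≤n) v≤n = ∈-map⁺ suc (∈-upTo⁺ v≤n)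

ColouredPart : (ℕ → ℕ) → ℕ → ℕ × ℕ → Set
ColouredPart cols n (v , c) = (1 ≤ v × v ≤ n) × c < cols v

∈-colouredParts⁻ : ∀ {cols n t} → t ∈ colouredParts cols n → ColouredPart cols n t
∈-colouredParts⁻ {cols} t∈
  with v , v∈ , t∈ᵥ ← find (∈-concatMap⁻ (λ v → map (v ,_) (upTo (cols v))) t∈)
  with c , c∈ , refl ← ∈-map⁻ (v ,_) t∈ᵥ = ∈-range1⁻ v∈ , ∈-upTo⁻ c∈

∈-colouredParts⁺ : ∀ {cols n t} → ColouredPart cols n t → t ∈ colouredParts cols n
∈-colouredParts⁺ {cols} {t = v , c} ((1≤v , v≤n) , c<cols) =
  ∈-concatMap⁺ (λ v → map (v ,_) (upTo (cols v)))
    (lose (∈-range1⁺ 1≤v v≤n) (∈-map⁺ (v ,_) (∈-upTo⁺ c<cols)))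

colouredParts-unique : ∀ cols n → Unique (colouredParts cols n)
colouredParts-unique cols n = concatMap-unique proj₁ value-∈ colours-unique range1-unique
  where
  value-∈ : ∀ {v t} → t ∈ map (v ,_) (upTo (cols v)) → proj₁ t ≡ v
  value-∈ t∈ with _ , _ , refl ← ∈-map⁻ _ t∈ = refl
  colours-unique : ∀ v → Unique (map (v ,_) (upTo (cols v)))
  colours-unique v = Unique.map⁺ ,-injectiveʳ (Unique.upTo⁺ (cols v))
  range1-unique : Unique (range1 n)
  range1-unique = Unique.map⁺ suc-injective (Unique.upTo⁺ n)

colours↓ : ℕ → ℕ → List (ℕ × ℕ)
colours↓ v zero    = []
colours↓ v (suc c) = (v , c) ∷ colours↓ v c

colouredParts↓ : (ℕ → ℕ) → ℕ → List (ℕ × ℕ)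
colouredParts↓ cols zero    = []
colouredParts↓ cols (suc n) = colours↓ (suc n) (cols (suc n)) ++ colouredParts↓ cols n

∈-colours↓⁻ : ∀ {v c t} → t ∈ colours↓ v c → proj₁ t ≡ v × proj₂ t < c
∈-colours↓⁻ {c = suc c} (here refl) = refl , ≤-refl
∈-colours↓⁻ {c = suc c} (there t∈) with refl , t<c ← ∈-colours↓⁻ t∈ = refl , m<n⇒m<1+n t<c

∈-colours↓⁺ : ∀ {v c d} → d < c → (v , d) ∈ colours↓ v c
∈-colours↓⁺ {c = suc c} {d} d<1+c with d ≟ c
... | yes refl = here refl
... | no d≢c   = there (∈-colours↓⁺ (≤∧≢⇒< (≤-pred d<1+c) d≢c))

∈-colouredParts↓⁻ : ∀ {cols n t} → t ∈ colouredParts↓ cols n → ColouredPart cols n t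
∈-colouredParts↓⁻ {cols} {suc n} t∈ with ∈-++⁻ (colours↓ (suc n) (cols (suc n))) t∈
... | inj₁ t∈ₙ with refl , c< ← ∈-colours↓⁻ t∈ₙ = (s≤s z≤n , ≤-refl) , c<
... | inj₂ t∈ₙ with (1≤v , v≤n) , c< ← ∈-colouredParts↓⁻ t∈ₙ = (1≤v , m≤n⇒m≤1+n v≤n) , c<

∈-colouredParts↓⁺ : ∀ {cols n t} → ColouredPart cols n t → t ∈ colouredParts↓ cols n
∈-colouredParts↓⁺ {n = zero} {v , c} ((1≤v , v≤0) , _) = contradiction v≤0 (<⇒≱ 1≤v)
∈-colouredParts↓⁺ {cols} {suc n} {v , c} ((1≤v , v≤1+n) , c<) with v ≟ suc n
... | yes refl = ∈-++⁺ˡ (∈-colours↓⁺ c<)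
... | no v≢1+n = ∈-++⁺ʳ (colours↓ (suc n) (cols (suc n)))
                   (∈-colouredParts↓⁺ ((1≤v , ≤-pred (≤∧≢⇒< v≤1+n v≢1+n)) , c<))

colouredParts↓-positive : ∀ cols n → All (λ t → 1 ≤ proj₁ t) (colouredParts↓ cols n)
colouredParts↓-positive cols n = All.tabulate (proj₁ ∘ proj₁ ∘ ∈-colouredParts↓⁻ {cols} {n})

_≻_ : ℕ × ℕ → ℕ × ℕ → Set
(v , c) ≻ (w , d) = w < v ⊎ (w ≡ v × d < c)

colouredParts↓-descending : ∀ cols n → AllPairs _≻_ (colouredParts↓ cols n)
colouredParts↓-descending cols zero    = []
colouredParts↓-descending cols (suc n) =
  AllPairs.++⁺ (colours↓-descending (cols (suc n))) (colouredParts↓-descending cols n)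
    (All.tabulate λ t∈ → All.tabulate λ u∈ → above (∈-colours↓⁻ t∈) (∈-colouredParts↓⁻ u∈))
  where
  colours↓-descending : ∀ c → AllPairs _≻_ (colours↓ (suc n) c)
  colours↓-descending zero    = []
  colours↓-descending (suc c) = All.tabulate (below ∘ ∈-colours↓⁻) ∷ colours↓-descending c
    where
    below : ∀ {t} → proj₁ t ≡ suc n × proj₂ t < c → (suc n , c) ≻ t
    below (refl , d<c) = inj₂ (refl , d<c)
  above : ∀ {t u} → proj₁ t ≡ suc n × proj₂ t < cols (suc n) → ColouredPart cols n u → t ≻ u
  above {_ , _} {_ , _} (refl , _) ((_ , w≤n) , _) = inj₁ (s≤s w≤n)

≻-irrefl : ∀ {t} → ¬ (t ≻ t)
≻-irrefl (inj₁ v<v)       = <-irrefl refl v<v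
≻-irrefl (inj₂ (_ , c<c)) = <-irrefl refl c<c

lexGeq-refl : ∀ t → T (lexGeq t t)
lexGeq-refl (v , c) =
  Equivalence.from T-∨ (inj₂ (Equivalence.from T-∧ (≡⇒≡ᵇ v v refl , ≤⇒≤ᵇ (≤-refl {c}))))

≻⇒lexGeq : ∀ {t u} → t ≻ u → T (lexGeq t u)
≻⇒lexGeq {v , _} (inj₁ w<v)         = Equivalence.from T-∨ (inj₁ (<⇒<ᵇ w<v))
≻⇒lexGeq {v , _} (inj₂ (refl , d<c)) =
  Equivalence.from T-∨ (inj₂ (Equivalence.from T-∧ (≡⇒≡ᵇ v v refl , ≤⇒≤ᵇ (<⇒≤ d<c))))

lexGeq⇒⊁ : ∀ {t u} → T (lexGeq u t) → ¬ (t ≻ u)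
lexGeq⇒⊁ {v , c} {w , d} u≥t t≻u with Equivalence.to T-∨ u≥t | t≻u
... | inj₁ v<ᵇw | inj₁ w<v        = <-asym w<v (<ᵇ⇒< v w v<ᵇw)
... | inj₁ v<ᵇw | inj₂ (refl , _) = <-irrefl refl (<ᵇ⇒< v w v<ᵇw)
... | inj₂ w≡v∧c≤d | _
  with w≡ᵇv , c≤ᵇd ← Equivalence.to T-∧ w≡v∧c≤d
  with refl ← ≡ᵇ⇒≡ w v w≡ᵇv
  with t≻u
...   | inj₁ w<w       = <-irrefl refl w<w
...   | inj₂ (_ , d<c) = <⇒≱ d<c (≤ᵇ⇒≤ c d c≤ᵇd)

lexDecreasing-head : ∀ {t u μ} → T (lexDecreasing (t ∷ u ∷ μ)) → T (lexGeq t u)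
lexDecreasing-head = proj₁ ∘ Equivalence.to T-∧

lexDecreasing-tail : ∀ {t μ} → T (lexDecreasing (t ∷ μ)) → T (lexDecreasing μ)
lexDecreasing-tail {μ = []}    _      = _
lexDecreasing-tail {μ = _ ∷ _} sorted = proj₂ (Equivalence.to T-∧ sorted)

PartitionOver : List (ℕ × ℕ) → ℕ → List (ℕ × ℕ) → Set
PartitionOver ts n μ = T (lexDecreasing μ) × All (_∈ ts) μ × sum (map proj₁ μ) ≡ n

length≤sum : ∀ {μ : List (ℕ × ℕ)} → All (λ t → 1 ≤ proj₁ t) μ → length μ ≤ sum (map proj₁ μ)
length≤sum []          = z≤n
length≤sum (1≤v ∷ 1≤μ) = +-mono-≤ 1≤v (length≤sum 1≤μ)

-- multisets ts n lists the multisets of elements of ts of total value n, each ordered as in ts;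
-- multisets≤ t ts c n lists those of t ∷ ts with at most c copies of t.
mutual
  multisets : List (ℕ × ℕ) → ℕ → List (List (ℕ × ℕ))
  multisets []       zero    = [] ∷ []
  multisets []       (suc n) = []
  multisets (t ∷ ts) n       = multisets≤ t ts n n

  multisets≤ : ℕ × ℕ → List (ℕ × ℕ) → ℕ → ℕ → List (List (ℕ × ℕ))
  multisets≤ t ts zero    n = multisets ts n
  multisets≤ t ts (suc c) n =
    multisets ts n ++ (if proj₁ t ≤ᵇ n then map (t ∷_) (multisets≤ t ts c (n ∸ proj₁ t)) else [])

multisets≤-saturated : ∀ {t ts c c′ n} → 1 ≤ proj₁ t → n ≤ c → n ≤ c′ →
                       multisets≤ t ts c n ≡ multisets≤ t ts c′ n
multisets≤-saturated {c = zero} {zero} {zero} _ _ _ = refl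
multisets≤-saturated {suc _ , _} {ts} {zero}  {suc _} {zero} _ _ _ = sym (++-identityʳ (multisets ts 0))
multisets≤-saturated {suc _ , _} {ts} {suc _} {zero}  {zero} _ _ _ = ++-identityʳ (multisets ts 0)
multisets≤-saturated {t@(suc v , _)} {ts} {suc c} {suc c′} {n} 1≤v n≤1+c n≤1+c′ with suc v ≤ᵇ n
... | false = refl
... | true  = cong (λ L → multisets ts n ++ map (t ∷_) L)
                   (multisets≤-saturated 1≤v (rest n≤1+c) (rest n≤1+c′))
  where
  rest : ∀ {c} → n ≤ suc c → n ∸ suc v ≤ c
  rest n≤1+c = ≤-trans (∸-monoʳ-≤ n (s≤s z≤n)) (∸-monoˡ-≤ 1 n≤1+c)

multisets-∷ : ∀ {t ts n} → 1 ≤ proj₁ t →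
  multisets (t ∷ ts) n
    ≡ multisets ts n ++ (if proj₁ t ≤ᵇ n then map (t ∷_) (multisets (t ∷ ts) (n ∸ proj₁ t)) else [])
multisets-∷ {suc v , _}     {ts} {zero}  _   = sym (++-identityʳ (multisets ts 0))
multisets-∷ {t@(suc v , _)} {ts} {suc m} 1≤v =
  cong (λ L → multisets ts (suc m) ++ (if suc v ≤ᵇ suc m then map (t ∷_) L else []))
       (multisets≤-saturated 1≤v (m∸n≤m m v) ≤-refl)

sorted-∷ : ∀ {t ts μ} → All (t ≻_) ts → T (lexDecreasing μ) → All (_∈ t ∷ ts) μ →
           T (lexDecreasing (t ∷ μ))
sorted-∷ {μ = []}    _    _      _                 = _
sorted-∷ {t} {μ = _ ∷ _} _ sorted (here refl ∷ _)  = Equivalence.from T-∧ (lexGeq-refl t , sorted)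
sorted-∷ {μ = _ ∷ _} t≻ts sorted (there u∈ts ∷ _) =
  Equivalence.from T-∧ (≻⇒lexGeq (All.lookup t≻ts u∈ts) , sorted)

mutual
  ∈-multisets⁻ : ∀ {ts n μ} → AllPairs _≻_ ts → μ ∈ multisets ts n → PartitionOver ts n μ
  ∈-multisets⁻ {[]}    {zero} _    (here refl) = _ , [] , refl
  ∈-multisets⁻ {_ ∷ _} {n}    desc μ∈          = ∈-multisets≤⁻ {c = n} desc μ∈

  ∈-multisets≤⁻ : ∀ {t ts c n μ} → AllPairs _≻_ (t ∷ ts) → μ ∈ multisets≤ t ts c n →
                  PartitionOver (t ∷ ts) n μ
  ∈-multisets≤⁻ {c = zero} (_ ∷ desc) μ∈ = widen (∈-multisets⁻ desc μ∈)
  ∈-multisets≤⁻ {t} {ts} {suc c} {n} (t≻ts ∷ desc) μ∈ with ∈-++⁻ (multisets ts n) μ∈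
  ... | inj₁ μ∈ₗ = widen (∈-multisets⁻ desc μ∈ₗ)
  ... | inj₂ μ∈ᵣ with proj₁ t ≤ᵇ n in v≤ᵇn
  ...   | true
    with μ′ , μ′∈ , refl ← ∈-map⁻ (t ∷_) μ∈ᵣ
    with sorted , μ′⊆ , sum≡ ← ∈-multisets≤⁻ {c = c} (t≻ts ∷ desc) μ′∈ =
    sorted-∷ t≻ts sorted μ′⊆ , here refl ∷ μ′⊆ ,
    trans (cong (proj₁ t +_) sum≡) (m+[n∸m]≡n (≤ᵇ⇒≤ (proj₁ t) n (Equivalence.from T-≡ v≤ᵇn)))

  widen : ∀ {t ts n μ} → PartitionOver ts n μ → PartitionOver (t ∷ ts) n μ
  widen (sorted , μ⊆ , sum≡) = sorted , All.map there μ⊆ , sum≡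

avoid-head : ∀ {t ts u μ} → All (t ≻_) ts → u ∈ ts → T (lexDecreasing (u ∷ μ)) →
             All (_∈ t ∷ ts) μ → All (_∈ ts) μ
avoid-head t≻ts u∈ts sorted [] = []
avoid-head {u = u} {_ ∷ μ} t≻ts u∈ts sorted (here refl ∷ _) =
  contradiction (All.lookup t≻ts u∈ts) (lexGeq⇒⊁ (lexDecreasing-head {u} {_} {μ} sorted))
avoid-head {u = u} {w ∷ μ} t≻ts u∈ts sorted (there w∈ts ∷ μ⊆) =
  w∈ts ∷ avoid-head t≻ts w∈ts (lexDecreasing-tail {u} {w ∷ μ} sorted) μ⊆

multisets⊆multisets≤ : ∀ t c {ts n μ} → μ ∈ multisets ts n → μ ∈ multisets≤ t ts c n
multisets⊆multisets≤ t zero    μ∈ = μ∈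
multisets⊆multisets≤ t (suc c) μ∈ = ∈-++⁺ˡ μ∈

mutual
  ∈-multisets⁺ : ∀ {ts n μ} → AllPairs _≻_ ts → All (λ t → 1 ≤ proj₁ t) ts →
                 PartitionOver ts n μ → μ ∈ multisets ts n
  ∈-multisets⁺ {[]}            _    _   (_ , [] , refl)      = here refl
  ∈-multisets⁺ {_ ∷ _} {μ = μ} desc pos p@(_ , μ⊆ , sum≡) =
    ∈-multisets≤⁺ desc pos p (subst (length μ ≤_) sum≡ (length≤sum (All.map (All.lookup pos) μ⊆)))

  ∈-multisets≤⁺ : ∀ {t ts c n μ} → AllPairs _≻_ (t ∷ ts) → All (λ t → 1 ≤ proj₁ t) (t ∷ ts) →
                  PartitionOver (t ∷ ts) n μ → length μ ≤ c → μ ∈ multisets≤ t ts c n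
  ∈-multisets≤⁺ {t} {c = c} {μ = []} (_ ∷ desc) (_ ∷ pos) (sorted , _ , sum≡) _ =
    multisets⊆multisets≤ t c (∈-multisets⁺ desc pos (sorted , [] , sum≡))
  ∈-multisets≤⁺ {t} {ts} {suc c} {n} {_ ∷ μ} desc pos (sorted , here refl ∷ μ⊆ , refl) (s≤s length≤c)
    rewrite ≤ᵇ-true (m≤m+n (proj₁ t) (sum (map proj₁ μ))) =
    ∈-++⁺ʳ (multisets ts n) (∈-map⁺ (t ∷_) (∈-multisets≤⁺ desc pos μ-partition length≤c))
    where
    μ-partition = lexDecreasing-tail {t} {μ} sorted , μ⊆ , sym (m+n∸m≡n (proj₁ t) _)
  ∈-multisets≤⁺ {t} {c = c} {μ = _ ∷ _} (t≻ts ∷ desc) (_ ∷ pos)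
                (sorted , there u∈ts ∷ μ⊆ , sum≡) _ =
    multisets⊆multisets≤ t c
      (∈-multisets⁺ desc pos (sorted , u∈ts ∷ avoid-head t≻ts u∈ts sorted μ⊆ , sum≡))

mutual
  multisets-unique : ∀ {ts} → AllPairs _≻_ ts → ∀ n → Unique (multisets ts n)
  multisets-unique {[]}    _    zero    = [] ∷ []
  multisets-unique {[]}    _    (suc n) = []
  multisets-unique {_ ∷ _} desc n       = multisets≤-unique desc n n

  multisets≤-unique : ∀ {t ts} → AllPairs _≻_ (t ∷ ts) → ∀ c n → Unique (multisets≤ t ts c n)
  multisets≤-unique (_ ∷ desc) zero n = multisets-unique desc n
  multisets≤-unique {t} {ts} (t≻ts ∷ desc) (suc c) n with proj₁ t ≤ᵇ n
  ... | false = Unique.++⁺ (multisets-unique desc n) [] (λ ())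
  ... | true  = Unique.++⁺ (multisets-unique desc n)
                  (Unique.map⁺ (proj₂ ∘ ∷-injective) (multisets≤-unique (t≻ts ∷ desc) c _)) disjoint
    where
    disjoint : ∀ {μ} → ¬ (μ ∈ multisets ts n × μ ∈ map (t ∷_) (multisets≤ t ts c (n ∸ proj₁ t)))
    disjoint (μ∈ₗ , μ∈ᵣ) with _ , _ , refl ← ∈-map⁻ (t ∷_) μ∈ᵣ
      with _ , t∈ts ∷ _ , _ ← ∈-multisets⁻ desc μ∈ₗ = ≻-irrefl (All.lookup t≻ts t∈ts)

isColouredPartitionᵇ : ℕ → List (ℕ × ℕ) → Bool
isColouredPartitionᵇ n μ = lexDecreasing μ ∧ (sum (map proj₁ μ) ≡ᵇ n)

∈-colouredPartitions⁻ : ∀ {cols n μ} → μ ∈ colouredPartitions cols n →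
                        PartitionOver (colouredParts↓ cols n) n μ
∈-colouredPartitions⁻ {cols} {n} μ∈
  with μ∈ₗ , sorted∧sum ← ∈-filter⁻ (T? ∘ isColouredPartitionᵇ n) μ∈
  with sorted , sum≡ᵇ ← Equivalence.to T-∧ sorted∧sum =
  sorted ,
  All.map (∈-colouredParts↓⁺ {cols} {n} ∘ ∈-colouredParts⁻) (proj₂ (∈-listsUpToLen⁻ n μ∈ₗ)) ,
  ≡ᵇ⇒≡ _ n sum≡ᵇ

∈-colouredPartitions⁺ : ∀ {cols n μ} → PartitionOver (colouredParts↓ cols n) n μ →
                        μ ∈ colouredPartitions cols n
∈-colouredPartitions⁺ {cols} {n} {μ} (sorted , μ⊆ , sum≡) =
  ∈-filter⁺ (T? ∘ isColouredPartitionᵇ n)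
    (∈-listsUpToLen⁺ n length≤n (All.map (∈-colouredParts⁺ {cols} {n} ∘ ∈-colouredParts↓⁻) μ⊆))
    (Equivalence.from T-∧ (sorted , ≡⇒≡ᵇ _ n sum≡))
  where
  length≤n : length μ ≤ n
  length≤n = subst (length μ ≤_) sum≡
               (length≤sum (All.map (All.lookup (colouredParts↓-positive cols n)) μ⊆))

colouredPartitions-unique : ∀ cols n → Unique (colouredPartitions cols n)
colouredPartitions-unique cols n =
  Unique.filter⁺ (T? ∘ isColouredPartitionᵇ n) (listsUpToLen-unique n (colouredParts-unique cols n))

colouredPartitions↭multisets : ∀ cols n → colouredPartitions cols n ↭ multisets (colouredParts↓ cols n) n
colouredPartitions↭multisets cols n = ∼bag⇒↭ (unique∧set⇒bag
  (colouredPartitions-unique cols n) (multisets-unique desc n)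
  (mk⇔ (∈-multisets⁺ desc (colouredParts↓-positive cols n) ∘ ∈-colouredPartitions⁻)
       (∈-colouredPartitions⁺ ∘ ∈-multisets⁻ desc)))
  where
  desc = colouredParts↓-descending cols n

sum-map-+ : ∀ {A : Set} (f g : A → ℕ) xs →
            sum (map (λ x → f x + g x) xs) ≡ sum (map f xs) + sum (map g xs)
sum-map-+ f g []       = refl
sum-map-+ f g (x ∷ xs) = trans (cong ((f x + g x) +_) (sum-map-+ f g xs)) (interchange (f x) (g x) _ _)

sum-map-zero : ∀ {A : Set} {f : A → ℕ} {xs} → All (λ x → f x ≡ 0) xs → sum (map f xs) ≡ 0
sum-map-zero []             = refl
sum-map-zero (fx≡0 ∷ fxs≡0) = cong₂ _+_ fx≡0 (sum-map-zero fxs≡0)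

length≡sum-map-1 : ∀ {A : Set} (xs : List A) → length xs ≡ sum (map (λ _ → 1) xs)
length≡sum-map-1 []       = refl
length≡sum-map-1 (_ ∷ xs) = cong suc (length≡sum-map-1 xs)

-- Coefficients of the series Σ_μ f μ q^|μ|, μ ranging over the multisets of ts.
gf : List (ℕ × ℕ) → (List (ℕ × ℕ) → ℕ) → ℕ → ℕ
gf ts f n = sum (map f (multisets ts n))

count : List (ℕ × ℕ) → ℕ → ℕ
count ts = gf ts (λ _ → 1)

-- weighted f j n sums f over the partitions of n with parts at most j;
-- coloured cols j n counts the coloured partitions of n with parts at most j.
weighted : (List ℕ → ℕ) → ℕ → ℕ → ℕ
weighted f j = gf (colouredParts↓ (λ _ → 1) j) (f ∘ map proj₁)

coloured : (ℕ → ℕ) → ℕ → ℕ → ℕ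
coloured cols j = count (colouredParts↓ cols j)

gf-cong : ∀ {ts f g} → (∀ μ → f μ ≡ g μ) → gf ts f ≗ gf ts g
gf-cong {ts} f≗g n = cong sum (map-cong f≗g (multisets ts n))

gf-+ : ∀ {ts} f g n → gf ts (λ μ → f μ + g μ) n ≡ gf ts f n + gf ts g n
gf-+ {ts} f g n = sum-map-+ f g (multisets ts n)

gf-zero : ∀ {ts f} → AllPairs _≻_ ts → (∀ {μ} → All (_∈ ts) μ → f μ ≡ 0) →
          ∀ n → gf ts f n ≡ 0
gf-zero desc f≡0 n = sum-map-zero (All.tabulate (f≡0 ∘ proj₁ ∘ proj₂ ∘ ∈-multisets⁻ desc))

gf-∷ : ∀ {t ts f} n → 1 ≤ proj₁ t →
       gf (t ∷ ts) f n ≡ gf ts f n + shift (proj₁ t) (gf (t ∷ ts) (f ∘ (t ∷_))) n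
gf-∷ {t@(v , _)} {ts} {f} n 1≤v = begin
  gf (t ∷ ts) f n
    ≡⟨ cong (sum ∘ map f) (multisets-∷ {t} {ts} {n} 1≤v) ⟩
  sum (map f (multisets ts n ++ more))
    ≡⟨ cong sum (map-++ f (multisets ts n) more) ⟩
  sum (map f (multisets ts n) ++ map f more)
    ≡⟨ sum-++ (map f (multisets ts n)) (map f more) ⟩
  gf ts f n + sum (map f more)
    ≡⟨ cong (gf ts f n +_) more-sum ⟩
  gf ts f n + shift v (gf (t ∷ ts) (f ∘ (t ∷_))) n
    ∎
  where
  open ≡-Reasoning
  more = if v ≤ᵇ n then map (t ∷_) (multisets (t ∷ ts) (n ∸ v)) else []
  more-sum : sum (map f more) ≡ shift v (gf (t ∷ ts) (f ∘ (t ∷_))) n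
  more-sum with v ≤? n
  ... | yes v≤n rewrite ≤ᵇ-true v≤n =
    trans (cong sum (sym (map-∘ (multisets (t ∷ ts) (n ∸ v))))) (sym (shift-≤ v≤n))
  ... | no v≰n  rewrite ≤ᵇ-false (≰⇒> v≰n) = sym (shift-< (≰⇒> v≰n))

gf-invariant : ∀ {t ts f} → 1 ≤ proj₁ t → (∀ μ → f (t ∷ μ) ≡ f μ) →
               gf (t ∷ ts) f ≗ gf ts f /[1-q^ proj₁ t ]
gf-invariant {t} {ts} {f} 1≤v f-inv n =
  trans (gf-∷ n 1≤v) (cong (gf ts f n +_) (shift-cong (λ _ → gf-cong {t ∷ ts} f-inv (n ∸ proj₁ t))))

multisets-above : ∀ {us ts n} → All (λ u → n < proj₁ u) us → multisets (us ++ ts) n ≡ multisets ts n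
multisets-above                   []           = refl
multisets-above {u ∷ us} {ts} {n} (n<u ∷ n<us) = begin
  multisets (u ∷ us ++ ts) n
    ≡⟨ multisets-∷ {u} {us ++ ts} {n} (≤-trans (s≤s z≤n) n<u) ⟩
  multisets (us ++ ts) n ++ (if proj₁ u ≤ᵇ n then more else [])
    ≡⟨ cong (λ b → multisets (us ++ ts) n ++ (if b then more else [])) (≤ᵇ-false n<u) ⟩
  multisets (us ++ ts) n ++ []
    ≡⟨ ++-identityʳ _ ⟩
  multisets (us ++ ts) n
    ≡⟨ multisets-above n<us ⟩
  multisets ts n
    ∎
  where
  open ≡-Reasoning
  more = map (u ∷_) (multisets (u ∷ us ++ ts) (n ∸ proj₁ u))

multisets-colouredParts↓ : ∀ cols {m j} → m ≤ j →
                           multisets (colouredParts↓ cols j) m ≡ multisets (colouredParts↓ cols m) m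
multisets-colouredParts↓ cols {m} m≤j =
  subst (λ j → multisets (colouredParts↓ cols j) m ≡ _) (m∸n+n≡m m≤j) (go (_ ∸ m))
  where
  go : ∀ e → multisets (colouredParts↓ cols (e + m)) m ≡ multisets (colouredParts↓ cols m) m
  go zero    = refl
  go (suc e) = trans (multisets-above (All.tabulate above)) (go e)
    where
    above : ∀ {u} → u ∈ colours↓ (suc (e + m)) (cols (suc (e + m))) → m < proj₁ u
    above u∈ = subst (m <_) (sym (proj₁ (∈-colours↓⁻ u∈))) (s≤s (m≤n+m m e))

countℤ-coloured : ∀ cols {m j} → m ≤ j → countℤ cols (ℤ.+ m) ≡ coloured cols j m
countℤ-coloured cols {m} {j} m≤j = begin
  length (colouredPartitions cols m)
    ≡⟨ ↭.↭-length (colouredPartitions↭multisets cols m) ⟩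
  length (multisets (colouredParts↓ cols m) m)
    ≡⟨ length≡sum-map-1 (multisets (colouredParts↓ cols m) m) ⟩
  sum (map (λ _ → 1) (multisets (colouredParts↓ cols m) m))
    ≡⟨ cong (sum ∘ map _) (multisets-colouredParts↓ cols m≤j) ⟨
  coloured cols j m
    ∎
  where open ≡-Reasoning

countℤ-negative : ∀ cols {n d} → n < d → countℤ cols (ℤ.+ n ℤ.- ℤ.+ d) ≡ 0
countℤ-negative cols {n} {d} n<d rewrite m-n≡m⊖n n d | ⊖-< n<d with d ∸ n | m>n⇒m∸n≢0 n<d
... | zero  | d∸n≢0 = contradiction refl d∸n≢0
... | suc _ | _     = refl

countℤ-∸ : ∀ cols n d → countℤ cols (ℤ.+ n ℤ.- ℤ.+ d) ≡ shift d (coloured cols n) n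
countℤ-∸ cols n d with d ≤? n
... | yes d≤n rewrite m-n≡m⊖n n d | ⊖-≥ d≤n =
  trans (countℤ-coloured cols (m∸n≤m n d)) (sym (shift-≤ d≤n))
... | no d≰n  = trans (countℤ-negative cols (≰⇒> d≰n)) (sym (shift-< (≰⇒> d≰n)))

filterᵇ-map : ∀ {A B : Set} (P : B → Bool) (g : A → B) xs →
              filterᵇ P (map g xs) ≡ map g (filterᵇ (P ∘ g) xs)
filterᵇ-map P g []       = refl
filterᵇ-map P g (x ∷ xs) with P (g x)
... | true  = cong (g x ∷_) (filterᵇ-map P g xs)
... | false = filterᵇ-map P g xs

filterᵇ-cong-∈ : ∀ {A : Set} {P Q : A → Bool} {xs} → (∀ {x} → x ∈ xs → P x ≡ Q x) →
                 filterᵇ P xs ≡ filterᵇ Q xs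
filterᵇ-cong-∈ {xs = []} _ = refl
filterᵇ-cong-∈ {P = P} {Q} {x ∷ xs} P≡Q with P x | Q x | P≡Q (here refl)
... | true  | true  | _ = cong (x ∷_) (filterᵇ-cong-∈ (P≡Q ∘ there))
... | false | false | _ = filterᵇ-cong-∈ (P≡Q ∘ there)

sum-map-filterᵇ : ∀ {A : Set} {P : A → Bool} {f : A → ℕ} xs → (∀ x → P x ≡ false → f x ≡ 0) →
                  sum (map f (filterᵇ P xs)) ≡ sum (map f xs)
sum-map-filterᵇ []                   _       = refl
sum-map-filterᵇ {P = P} {f} (x ∷ xs) dropped with P x in Px
... | true  = cong (f x +_) (sum-map-filterᵇ xs dropped)
... | false = trans (sum-map-filterᵇ xs dropped) (cong (_+ sum (map f xs)) (sym (dropped x Px)))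

listsOf-map : ∀ {A B : Set} (g : A → B) l xs → listsOf l (map g xs) ≡ map (map g) (listsOf l xs)
listsOf-map g zero    xs = refl
listsOf-map g (suc l) xs = begin
  concatMap (λ y → map (y ∷_) (listsOf l (map g xs))) (map g xs)  ≡⟨ concatMap-map _ g xs ⟩
  concatMap (λ x → map (g x ∷_) (listsOf l (map g xs))) xs        ≡⟨ concatMap-cong cons-map xs ⟩
  concatMap (λ x → map (map g) (map (x ∷_) (listsOf l xs))) xs    ≡⟨ map-concatMap (map g) _ xs ⟨
  map (map g) (concatMap (λ x → map (x ∷_) (listsOf l xs)) xs)    ∎
  where
  open ≡-Reasoning
  cons-map : ∀ x → map (g x ∷_) (listsOf l (map g xs)) ≡ map (map g) (map (x ∷_) (listsOf l xs))
  cons-map x = begin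
    map (g x ∷_) (listsOf l (map g xs))        ≡⟨ cong (map (g x ∷_)) (listsOf-map g l xs) ⟩
    map (g x ∷_) (map (map g) (listsOf l xs))  ≡⟨ map-∘ (listsOf l xs) ⟨
    map (map g ∘ (x ∷_)) (listsOf l xs)        ≡⟨ map-∘ (listsOf l xs) ⟩
    map (map g) (map (x ∷_) (listsOf l xs))    ∎

listsUpToLen-map : ∀ {A B : Set} (g : A → B) n xs →
                   listsUpToLen n (map g xs) ≡ map (map g) (listsUpToLen n xs)
listsUpToLen-map g n xs = trans (concatMap-cong (λ l → listsOf-map g l xs) (upTo (suc n)))
                                (sym (map-concatMap (map g) (λ l → listsOf l xs) (upTo (suc n))))

colouredParts-monochrome : ∀ n → colouredParts (λ _ → 1) n ≡ map (_, 0) (range1 n)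
colouredParts-monochrome n =
  trans (sym (concatMap-map [_] (_, 0) (range1 n))) (concatMap-pure (map (_, 0) (range1 n)))

<ᵇ-suc : ∀ m n → (m <ᵇ suc n) ≡ (m ≤ᵇ n)
<ᵇ-suc zero    n = refl
<ᵇ-suc (suc m) n = refl

≤ᵇ-lexGeq : ∀ m n → (n ≤ᵇ m) ≡ lexGeq (m , 0) (n , 0)
≤ᵇ-lexGeq zero    zero    = refl
≤ᵇ-lexGeq zero    (suc n) = refl
≤ᵇ-lexGeq (suc m) zero    = refl
≤ᵇ-lexGeq (suc m) (suc n) = trans (<ᵇ-suc n m) (≤ᵇ-lexGeq m n)

weaklyDecreasing-monochrome : ∀ xs → weaklyDecreasing xs ≡ lexDecreasing (map (_, 0) xs)
weaklyDecreasing-monochrome []           = refl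
weaklyDecreasing-monochrome (x ∷ [])     = refl
weaklyDecreasing-monochrome (x ∷ y ∷ xs) =
  cong₂ _∧_ (≤ᵇ-lexGeq x y) (weaklyDecreasing-monochrome (y ∷ xs))

values-monochrome : ∀ (xs : List ℕ) → map proj₁ (map (_, 0) xs) ≡ xs
values-monochrome xs = trans (sym (map-∘ xs)) (map-id xs)

all-positive : ∀ {xs} → All (1 ≤_) xs → all (1 ≤ᵇ_) xs ≡ true
all-positive []               = refl
all-positive (s≤s z≤n ∷ 1≤xs) = all-positive 1≤xs

isPartitionᵇ-monochrome : ∀ n {xs} → All (1 ≤_) xs →
                          isPartitionᵇ n xs ≡ isColouredPartitionᵇ n (map (_, 0) xs)
isPartitionᵇ-monochrome n {xs} 1≤xs rewrite all-positive 1≤xs =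
  cong₂ (λ b ys → b ∧ (sum ys ≡ᵇ n)) (weaklyDecreasing-monochrome xs) (sym (values-monochrome xs))

𝒫-monochrome : ∀ n → map (map (_, 0)) (𝒫 n) ≡ colouredPartitions (λ _ → 1) n
𝒫-monochrome n = begin
  map (map (_, 0)) (filterᵇ (isPartitionᵇ n) L)
    ≡⟨ cong (map (map (_, 0))) (filterᵇ-cong-∈ monochrome) ⟩
  map (map (_, 0)) (filterᵇ (isColouredPartitionᵇ n ∘ map (_, 0)) L)
    ≡⟨ filterᵇ-map (isColouredPartitionᵇ n) (map (_, 0)) L ⟨
  filterᵇ (isColouredPartitionᵇ n) (map (map (_, 0)) L)
    ≡⟨ cong (filterᵇ (isColouredPartitionᵇ n)) (listsUpToLen-map (_, 0) n (range1 n)) ⟨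
  filterᵇ (isColouredPartitionᵇ n) (listsUpToLen n (map (_, 0) (range1 n)))
    ≡⟨ cong (filterᵇ (isColouredPartitionᵇ n) ∘ listsUpToLen n) (colouredParts-monochrome n) ⟨
  colouredPartitions (λ _ → 1) n
    ∎
  where
  open ≡-Reasoning
  L = listsUpToLen n (range1 n)
  monochrome : ∀ {xs} → xs ∈ L → isPartitionᵇ n xs ≡ isColouredPartitionᵇ n (map (_, 0) xs)
  monochrome xs∈ =
    isPartitionᵇ-monochrome n (All.map (proj₁ ∘ ∈-range1⁻) (proj₂ (∈-listsUpToLen⁻ n xs∈)))

choose-short : ∀ k (xs : List ℕ) → length xs < k → choose k xs ≡ []
choose-short (suc k) []       _         = refl
choose-short (suc k) (x ∷ xs) (s≤s l<k)
  rewrite choose-short k xs l<k | choose-short (suc k) xs (m<n⇒m<1+n l<k) = refl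

a≡weighted : ∀ {i k} (g : List ℕ → ℕ) → (∀ xs → mult (pre k xs) i ≡ g xs) → ∀ n →
             a i k n ≡ weighted g n n
a≡weighted {i} {k} g mult-pre≡g n = begin
  sum (map (λ ν → mult ν i) (map (pre k) (filterᵇ long (𝒫 n))))
    ≡⟨ cong sum (map-∘ (filterᵇ long (𝒫 n))) ⟨
  sum (map (λ xs → mult (pre k xs) i) (filterᵇ long (𝒫 n)))
    ≡⟨ sum-map-filterᵇ (𝒫 n) short ⟩
  sum (map (λ xs → mult (pre k xs) i) (𝒫 n))
    ≡⟨ cong sum (map-cong mult-pre≡g (𝒫 n)) ⟩
  sum (map g (𝒫 n))
    ≡⟨ cong sum (map-cong (cong g ∘ sym ∘ values-monochrome) (𝒫 n)) ⟩
  sum (map (g ∘ map proj₁ ∘ map (_, 0)) (𝒫 n))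
    ≡⟨ cong sum (map-∘ (𝒫 n)) ⟩
  sum (map (g ∘ map proj₁) (map (map (_, 0)) (𝒫 n)))
    ≡⟨ cong (sum ∘ map (g ∘ map proj₁)) (𝒫-monochrome n) ⟩
  sum (map (g ∘ map proj₁) (colouredPartitions (λ _ → 1) n))
    ≡⟨ sum-↭ (↭.map⁺ (g ∘ map proj₁) (colouredPartitions↭multisets _ n)) ⟩
  weighted g n n
    ∎
  where
  open ≡-Reasoning
  long : List ℕ → Bool
  long xs = k ≤ᵇ length xs
  short : ∀ xs → long xs ≡ false → mult (pre k xs) i ≡ 0
  short xs k≰ᵇl with k ≤? length xs
  ... | yes k≤l = contradiction (trans (sym (≤ᵇ-true k≤l)) k≰ᵇl) λ ()
  ... | no k≰l  rewrite choose-short k xs (≰⇒> k≰l) = refl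

mult-∷-≡ : ∀ i xs → mult (i ∷ xs) i ≡ suc (mult xs i)
mult-∷-≡ i xs = cong length (filter-accept (T? ∘ (_≡ᵇ i)) {i} {xs} (≡⇒≡ᵇ i i refl))

mult-∷-≢ : ∀ {x i} xs → x ≢ i → mult (x ∷ xs) i ≡ mult xs i
mult-∷-≢ {x} {i} xs x≢i = cong length (filter-reject (T? ∘ (_≡ᵇ i)) {x} {xs} (x≢i ∘ ≡ᵇ⇒≡ x i))

mult-++ : ∀ xs ys i → mult (xs ++ ys) i ≡ mult xs i + mult ys i
mult-++ xs ys i = trans (cong length (filter-++ (T? ∘ (_≡ᵇ i)) xs ys)) (length-++ (filterᵇ (_≡ᵇ i) xs))

mult-none : ∀ {i xs} → All (_≢ i) xs → mult xs i ≡ 0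
mult-none []                         = refl
mult-none {xs = _ ∷ xs} (x≢i ∷ xs≢i) = trans (mult-∷-≢ xs x≢i) (mult-none xs≢i)

mult-replicate : ∀ m i → mult (replicate m i) i ≡ m
mult-replicate zero    i = refl
mult-replicate (suc m) i = trans (mult-∷-≡ i (replicate m i)) (cong suc (mult-replicate m i))

mult-map : ∀ {f : ℕ → ℕ} {t s} → f s ≡ t → (∀ {y} → f y ≡ t → y ≡ s) → ∀ ys →
           mult (map f ys) t ≡ mult ys s
mult-map _ _ [] = refl
mult-map {f} {t} {s} fs≡t only (y ∷ ys) with y ≟ s
... | yes refl = begin
  mult (f s ∷ map f ys) t  ≡⟨ cong (λ z → mult (z ∷ map f ys) t) fs≡t ⟩
  mult (t ∷ map f ys) t    ≡⟨ mult-∷-≡ t (map f ys) ⟩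
  suc (mult (map f ys) t)  ≡⟨ cong suc (mult-map fs≡t only ys) ⟩
  suc (mult ys s)          ≡⟨ mult-∷-≡ s ys ⟨
  mult (s ∷ ys) s          ∎
  where open ≡-Reasoning
... | no y≢s =
  trans (mult-∷-≢ (map f ys) (y≢s ∘ only)) (trans (mult-map fs≡t only ys) (sym (mult-∷-≢ ys y≢s)))

mult-map-none : ∀ {f : ℕ → ℕ} {t} → (∀ y → f y ≢ t) → ∀ ys → mult (map f ys) t ≡ 0
mult-map-none     _   []       = refl
mult-map-none {f} f≢t (y ∷ ys) = trans (mult-∷-≢ (map f ys) (f≢t y)) (mult-map-none f≢t ys)

mult-pre-suc-∷ : ∀ k x xs t →
                 mult (pre (suc k) (x ∷ xs)) t ≡ mult (map (x *_) (pre k xs)) t + mult (pre (suc k) xs) t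
mult-pre-suc-∷ k x xs t = begin
  mult (map product (with-x ++ choose (suc k) xs)) t
    ≡⟨ cong (λ L → mult L t) (map-++ product with-x (choose (suc k) xs)) ⟩
  mult (map product with-x ++ pre (suc k) xs) t
    ≡⟨ mult-++ (map product with-x) (pre (suc k) xs) t ⟩
  mult (map product with-x) t + mult (pre (suc k) xs) t
    ≡⟨ cong (λ L → mult L t + mult (pre (suc k) xs) t) product-∷ ⟩
  mult (map (x *_) (pre k xs)) t + mult (pre (suc k) xs) t
    ∎
  where
  open ≡-Reasoning
  with-x = map (x ∷_) (choose k xs)
  product-∷ : map product with-x ≡ map (x *_) (pre k xs)
  product-∷ = trans (sym (map-∘ (choose k xs))) (map-∘ (choose k xs))

mult-pre-1 : ∀ k xs → mult (pre k xs) 1 ≡ mult xs 1 C k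
mult-pre-1 zero    xs       = refl
mult-pre-1 (suc k) []       = refl
mult-pre-1 (suc k) (x ∷ xs) with x ≟ 1
... | yes refl = begin
  mult (pre (suc k) (1 ∷ xs)) 1
    ≡⟨ mult-pre-suc-∷ k 1 xs 1 ⟩
  mult (map (1 *_) (pre k xs)) 1 + mult (pre (suc k) xs) 1
    ≡⟨ cong (_+ mult (pre (suc k) xs) 1) (mult-map refl (λ {y} → trans (sym (*-identityˡ y))) (pre k xs)) ⟩
  mult (pre k xs) 1 + mult (pre (suc k) xs) 1
    ≡⟨ cong₂ _+_ (mult-pre-1 k xs) (mult-pre-1 (suc k) xs) ⟩
  mult xs 1 C k + mult xs 1 C suc k
    ≡⟨ nCk+nC[k+1]≡[n+1]C[k+1] (mult xs 1) k ⟩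
  suc (mult xs 1) C suc k
    ≡⟨ cong (_C suc k) (mult-∷-≡ 1 xs) ⟨
  mult (1 ∷ xs) 1 C suc k
    ∎
  where open ≡-Reasoning
... | no x≢1 = begin
  mult (pre (suc k) (x ∷ xs)) 1
    ≡⟨ mult-pre-suc-∷ k x xs 1 ⟩
  mult (map (x *_) (pre k xs)) 1 + mult (pre (suc k) xs) 1
    ≡⟨ cong₂ _+_ (mult-map-none (λ y → x≢1 ∘ m*n≡1⇒m≡1 x y) (pre k xs)) (mult-pre-1 (suc k) xs) ⟩
  mult xs 1 C suc k
    ≡⟨ cong (_C suc k) (mult-∷-≢ xs x≢1) ⟨
  mult (x ∷ xs) 1 C suc k
    ∎
  where open ≡-Reasoning

module _ {p : ℕ} (p-prime : Prime p) where

  private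
    p≢1 : p ≢ 1
    p≢1 = >⇒≢ (nonTrivial⇒n>1 p {{prime⇒nonTrivial p-prime}})

    p*y≡p⇒y≡1 : ∀ {y} → p * y ≡ p → y ≡ 1
    p*y≡p⇒y≡1 {y} p*y≡p =
      *-cancelˡ-≡ y 1 p {{prime⇒nonZero p-prime}} (trans p*y≡p (sym (*-identityʳ p)))

    x*y≢p : ∀ {x} → x ≢ 1 → x ≢ p → ∀ y → x * y ≢ p
    x*y≢p {x} x≢1 x≢p y x*y≡p =
      [ x≢1 , x≢p ]′ (prime⇒irreducible p-prime (divides y (trans (sym x*y≡p) (*-comm x y))))

  MultPrePrime : List ℕ → Set
  MultPrePrime xs = ∀ k → mult (pre (suc k) xs) p ≡ mult xs p * (mult xs 1 C k)

  mult-pre-prime-1∷ : ∀ {xs} → MultPrePrime xs → MultPrePrime (1 ∷ xs)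
  mult-pre-prime-1∷ {xs} ih k = begin
    mult (pre (suc k) (1 ∷ xs)) p
      ≡⟨ mult-pre-suc-∷ k 1 xs p ⟩
    mult (map (1 *_) (pre k xs)) p + mult (pre (suc k) xs) p
      ≡⟨ cong₂ _+_ (mult-map (*-identityˡ p) (λ {y} → trans (sym (*-identityˡ y))) (pre k xs)) (ih k) ⟩
    mult (pre k xs) p + mₚ * (m₁ C k)
      ≡⟨ pascal k ⟩
    mₚ * (suc m₁ C k)
      ≡⟨ cong₂ (λ m m′ → m * (m′ C k)) (mult-∷-≢ xs (p≢1 ∘ sym)) (mult-∷-≡ 1 xs) ⟨
    mult (1 ∷ xs) p * (mult (1 ∷ xs) 1 C k)
      ∎
    where
    open ≡-Reasoning
    mₚ = mult xs p
    m₁ = mult xs 1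
    pascal : ∀ k → mult (pre k xs) p + mₚ * (m₁ C k) ≡ mₚ * (suc m₁ C k)
    pascal zero    = cong (_+ mₚ * 1) (mult-∷-≢ [] (p≢1 ∘ sym))
    pascal (suc k) = begin
      mult (pre (suc k) xs) p + mₚ * (m₁ C suc k)  ≡⟨ cong (_+ mₚ * (m₁ C suc k)) (ih k) ⟩
      mₚ * (m₁ C k) + mₚ * (m₁ C suc k)            ≡⟨ *-distribˡ-+ mₚ (m₁ C k) (m₁ C suc k) ⟨
      mₚ * (m₁ C k + m₁ C suc k)                   ≡⟨ cong (mₚ *_) (nCk+nC[k+1]≡[n+1]C[k+1] m₁ k) ⟩
      mₚ * (suc m₁ C suc k)                        ∎

  mult-pre-prime-p∷ : ∀ {xs} → MultPrePrime xs → MultPrePrime (p ∷ xs)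
  mult-pre-prime-p∷ {xs} ih k = begin
    mult (pre (suc k) (p ∷ xs)) p
      ≡⟨ mult-pre-suc-∷ k p xs p ⟩
    mult (map (p *_) (pre k xs)) p + mult (pre (suc k) xs) p
      ≡⟨ cong₂ _+_ (mult-map (*-identityʳ p) p*y≡p⇒y≡1 (pre k xs)) (ih k) ⟩
    mult (pre k xs) 1 + mult xs p * (mult xs 1 C k)
      ≡⟨ cong (_+ mult xs p * (mult xs 1 C k)) (mult-pre-1 k xs) ⟩
    suc (mult xs p) * (mult xs 1 C k)
      ≡⟨ cong₂ (λ m m′ → m * (m′ C k)) (mult-∷-≡ p xs) (mult-∷-≢ xs p≢1) ⟨
    mult (p ∷ xs) p * (mult (p ∷ xs) 1 C k)
      ∎
    where open ≡-Reasoning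

  mult-pre-prime-∷ : ∀ {x xs} → x ≢ 1 → x ≢ p → MultPrePrime xs → MultPrePrime (x ∷ xs)
  mult-pre-prime-∷ {x} {xs} x≢1 x≢p ih k = begin
    mult (pre (suc k) (x ∷ xs)) p
      ≡⟨ mult-pre-suc-∷ k x xs p ⟩
    mult (map (x *_) (pre k xs)) p + mult (pre (suc k) xs) p
      ≡⟨ cong₂ _+_ (mult-map-none (x*y≢p x≢1 x≢p) (pre k xs)) (ih k) ⟩
    mult xs p * (mult xs 1 C k)
      ≡⟨ cong₂ (λ m m′ → m * (m′ C k)) (mult-∷-≢ xs x≢p) (mult-∷-≢ xs x≢1) ⟨
    mult (x ∷ xs) p * (mult (x ∷ xs) 1 C k)
      ∎
    where open ≡-Reasoning

  mult-pre-prime : ∀ xs → MultPrePrime xs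
  mult-pre-prime []       k = refl
  mult-pre-prime (x ∷ xs) with x ≟ 1 | x ≟ p
  ... | yes refl | _        = mult-pre-prime-1∷ (mult-pre-prime xs)
  ... | no _     | yes refl = mult-pre-prime-p∷ (mult-pre-prime xs)
  ... | no x≢1   | no x≢p   = mult-pre-prime-∷ x≢1 x≢p (mult-pre-prime xs)

binomial-/[1-q] : ∀ k → (_C suc k) ≗ shift 1 (_C k) /[1-q^ 1 ]
binomial-/[1-q] k zero    = sym (cong₂ _+_ (shift-< (s≤s z≤n)) (shift-< (s≤s z≤n)))
binomial-/[1-q] k (suc n) =
  sym (trans (cong₂ _+_ (shift-≤ (s≤s z≤n)) (shift-≤ (s≤s z≤n))) (nCk+nC[k+1]≡[n+1]C[k+1] n k))

binomial-series : ∀ k → (_C k) ≗ shift k (count (colours↓ 1 (suc k)))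
binomial-series zero n =
  trans (/[1-q^]-unique (s≤s z≤n) C0 (gf-invariant (s≤s z≤n) (λ _ → refl)) n) (sym (shift-≤ z≤n))
  where
  C0 : (_C 0) ≗ count [] /[1-q^ 1 ]
  C0 zero    = sym (cong (1 +_) (shift-< (s≤s z≤n)))
  C0 (suc n) = sym (shift-≤ (s≤s z≤n))
binomial-series (suc k) =
  /[1-q^]-shift (suc k) (s≤s z≤n) (binomial-/[1-q] k) (gf-invariant (s≤s z≤n) (λ _ → refl))
    (λ n → trans (shift-cong (λ _ → binomial-series k (n ∸ 1))) (shift-shift 1 k _ n))

-- A part t ignored by the weight contributes the same factor 1/(1 - q^v) to both sides.
shift-extend : ∀ {t Xs Ys f d} → 1 ≤ proj₁ t → (∀ μ → f (t ∷ μ) ≡ f μ) →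
               gf Xs f ≗ shift d (count Ys) → gf (t ∷ Xs) f ≗ shift d (count (t ∷ Ys))
shift-extend {d = d} 1≤v f-inv =
  /[1-q^]-shift d 1≤v (gf-invariant 1≤v f-inv) (gf-invariant 1≤v (λ _ → refl))

-- A weight that counts the copies of the part (v , c) turns its factor into q^v / (1 - q^v)²,
-- which is q^v times the factor of the value v in two colours.
shift-extend-counted : ∀ {v c c′ Xs Ys f g d} → 1 ≤ v → (∀ μ → g ((v , c) ∷ μ) ≡ g μ) →
                       (∀ μ → f ((v , c) ∷ μ) ≡ g μ + f μ) → (∀ n → gf Xs f n ≡ 0) →
                       gf Xs g ≗ shift d (count Ys) →
                       gf ((v , c) ∷ Xs) f ≗ shift (v + d) (count ((v , c′) ∷ (v , c) ∷ Ys))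
shift-extend-counted {v} {c} {c′} {Xs} {Ys} {f} {g} {d} 1≤v g-inv f-step f≡0 g≗ =
  /[1-q^]-shift (v + d) 1≤v F≗ (gf-invariant 1≤v (λ _ → refl))
    (λ n → trans (shift-cong (λ _ → G≗ _)) (shift-shift v d _ n))
  where
  t = (v , c)
  G≗ : gf (t ∷ Xs) g ≗ shift d (count (t ∷ Ys))
  G≗ = shift-extend 1≤v g-inv g≗
  F≗ : gf (t ∷ Xs) f ≗ shift v (gf (t ∷ Xs) g) /[1-q^ v ]
  F≗ n = begin
    gf (t ∷ Xs) f n
      ≡⟨ gf-∷ n 1≤v ⟩
    gf Xs f n + shift v (gf (t ∷ Xs) (f ∘ (t ∷_))) n
      ≡⟨ cong₂ _+_ (f≡0 n) (shift-cong (λ _ → gf-cong {t ∷ Xs} f-step (n ∸ v))) ⟩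
    shift v (gf (t ∷ Xs) (λ μ → g μ + f μ)) n
      ≡⟨ shift-cong (λ _ → gf-+ {t ∷ Xs} g f (n ∸ v)) ⟩
    shift v (λ m → gf (t ∷ Xs) g m + gf (t ∷ Xs) f m) n
      ≡⟨ shift-+ v n ⟩
    shift v (gf (t ∷ Xs) g) n + shift v (gf (t ∷ Xs) f) n
      ∎
    where open ≡-Reasoning

Neutral : (ℕ → ℕ) → (List ℕ → ℕ) → ℕ → Set
Neutral cols f v = cols v ≡ 1 × (∀ xs → f (v ∷ xs) ≡ f xs)

shift-extend-neutral : ∀ cols f {d i j} → i ≤ j → (∀ {v} → i < v → v ≤ j → Neutral cols f v) →
                       weighted f i ≗ shift d (coloured cols i) → weighted f j ≗ shift d (coloured cols j)
shift-extend-neutral cols f {j = zero} z≤n _ rel = rel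
shift-extend-neutral cols f {d} {i} {suc j} i≤1+j neutral rel with m≤n⇒m<n∨m≡n i≤1+j
... | inj₂ refl = rel
... | inj₁ (s≤s i≤j) with cols-1 , f-inv ← neutral (s≤s i≤j) ≤-refl rewrite cols-1 =
  shift-extend (s≤s z≤n) (f-inv ∘ map proj₁)
    (shift-extend-neutral cols f i≤j (λ i<v v≤j → neutral i<v (m≤n⇒m≤1+n v≤j)) rel)

multisets-ones : ∀ c m → multisets ((1 , c) ∷ []) m ≡ replicate m (1 , c) ∷ []
multisets-ones c zero    = refl
multisets-ones c (suc m) =
  trans (multisets-∷ {1 , c} {[]} {suc m} (s≤s z≤n)) (cong (map ((1 , c) ∷_)) (multisets-ones c m))

shift-ones : ∀ cols k → cols 1 ≡ suc k → weighted (λ xs → mult xs 1 C k) 1 ≗ shift k (coloured cols 1)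
shift-ones cols k cols-1 m = begin
  weighted (λ xs → mult xs 1 C k) 1 m
    ≡⟨ cong (sum ∘ map _) (multisets-ones 0 m) ⟩
  mult (map proj₁ (replicate m (1 , 0))) 1 C k + 0
    ≡⟨ cong (λ xs → mult xs 1 C k + 0) (map-replicate proj₁ m (1 , 0)) ⟩
  mult (replicate m 1) 1 C k + 0
    ≡⟨ cong (λ x → x C k + 0) (mult-replicate m 1) ⟩
  m C k + 0
    ≡⟨ +-identityʳ (m C k) ⟩
  m C k
    ≡⟨ binomial-series k m ⟩
  shift k (count (colours↓ 1 (suc k))) m
    ≡⟨ shift-cong (λ _ → cong (λ ts → count ts (m ∸ k)) colours-1) ⟩
  shift k (coloured cols 1) m
    ∎
  where
  open ≡-Reasoning
  colours-1 : colours↓ 1 (suc k) ≡ colouredParts↓ cols 1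
  colours-1 = trans (sym (++-identityʳ _)) (cong (λ c → colours↓ 1 c ++ []) (sym cols-1))

a₁≡c : ∀ n k → 1 ≤ n → a 1 k n ≡ c (suc k) (ℤ.+ n ℤ.- ℤ.+ k)
a₁≡c n k 1≤n = begin
  a 1 k n                      ≡⟨ a≡weighted {k = k} f (mult-pre-1 k) n ⟩
  weighted f n n               ≡⟨ shift-extend-neutral cols f 1≤n neutral (shift-ones cols k refl) n ⟩
  shift k (coloured cols n) n  ≡⟨ countℤ-∸ cols n k ⟨
  c (suc k) (ℤ.+ n ℤ.- ℤ.+ k)  ∎
  where
  open ≡-Reasoning
  f : List ℕ → ℕ
  f xs = mult xs 1 C k
  cols : ℕ → ℕ
  cols v = if v ≡ᵇ 1 then suc k else 1
  neutral : ∀ {v} → 1 < v → v ≤ n → Neutral cols f v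
  neutral 1<v _ =
    cong (if_then suc k else 1) (≢⇒≡ᵇ-false (>⇒≢ 1<v)) ,
    λ xs → cong (_C k) (mult-∷-≢ xs (>⇒≢ 1<v))

n-p-[1+k]+1≡n-[p+k] : ∀ n p k →
                      ℤ.+ n ℤ.- ℤ.+ p ℤ.- ℤ.+ suc k ℤ.+ ℤ.+ 1 ≡ ℤ.+ n ℤ.- ℤ.+ (p + k)
n-p-[1+k]+1≡n-[p+k] n p k = identity (ℤ.+ n) (ℤ.+ p) (ℤ.+ k)
  where
  identity : ∀ (x y z : ℤ.ℤ) → x ℤ.- y ℤ.- (ℤ.+ 1 ℤ.+ z) ℤ.+ ℤ.+ 1 ≡ x ℤ.- (y ℤ.+ z)
  identity = solve-∀

module _ {p′ : ℕ} (p-prime : Prime (suc p′)) (k : ℕ) where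

  private
    p : ℕ
    p = suc p′

    1<p : 1 < p
    1<p = nonTrivial⇒n>1 p {{prime⇒nonTrivial p-prime}}

    f g : List ℕ → ℕ
    f xs = mult xs p * (mult xs 1 C k)
    g xs = mult xs 1 C k

    g-∷ : ∀ {v} → v ≢ 1 → ∀ xs → g (v ∷ xs) ≡ g xs
    g-∷ v≢1 xs = cong (_C k) (mult-∷-≢ xs v≢1)

    f-∷ : ∀ {v} → v ≢ 1 → v ≢ p → ∀ xs → f (v ∷ xs) ≡ f xs
    f-∷ v≢1 v≢p xs = cong₂ (λ mₚ m₁ → mₚ * (m₁ C k)) (mult-∷-≢ xs v≢p) (mult-∷-≢ xs v≢1)

    f-p∷ : ∀ xs → f (p ∷ xs) ≡ g xs + f xs
    f-p∷ xs = cong₂ (λ mₚ m₁ → mₚ * (m₁ C k)) (mult-∷-≡ p xs) (mult-∷-≢ xs (>⇒≢ 1<p))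

    cols : ℕ → ℕ
    cols v = if v ≡ᵇ 1 then suc k else (if v ≡ᵇ p then 2 else 1)

    cols-one : ∀ {v} → v ≢ 1 → v ≢ p → cols v ≡ 1
    cols-one v≢1 v≢p rewrite ≢⇒≡ᵇ-false v≢1 | ≢⇒≡ᵇ-false v≢p = refl

    cols-p : cols p ≡ 2
    cols-p rewrite ≢⇒≡ᵇ-false (>⇒≢ 1<p) | Equivalence.to T-≡ (≡⇒≡ᵇ p p refl) = refl

    below-p-vanishes : ∀ {j} → j < p → ∀ n → weighted f j n ≡ 0
    below-p-vanishes {j} j<p =
      gf-zero (colouredParts↓-descending _ j)
        (λ μ⊆ → cong (_* _) (mult-none (All.map⁺ (All.map value≢p μ⊆))))
      where
      value≢p : ∀ {t} → t ∈ colouredParts↓ (λ _ → 1) j → proj₁ t ≢ p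
      value≢p t∈ = <⇒≢ (≤-<-trans (proj₂ (proj₁ (∈-colouredParts↓⁻ t∈))) j<p)

    below-p : weighted g p′ ≗ shift k (coloured cols p′)
    below-p = shift-extend-neutral cols g (≤-pred 1<p) neutral (shift-ones cols k refl)
      where
      neutral : ∀ {v} → 1 < v → v ≤ p′ → Neutral cols g v
      neutral 1<v v≤p′ = cols-one (>⇒≢ 1<v) (<⇒≢ (s≤s v≤p′)) , g-∷ (>⇒≢ 1<v)

    at-p : weighted f p ≗ shift (p + k) (coloured cols p)
    at-p rewrite cols-p =
      shift-extend-counted (s≤s z≤n) (g-∷ (>⇒≢ 1<p) ∘ map proj₁) (f-p∷ ∘ map proj₁)
        (below-p-vanishes ≤-refl) below-p

    above-p : ∀ {n} → p ≤ n → weighted f n ≗ shift (p + k) (coloured cols n)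
    above-p p≤n = shift-extend-neutral cols f p≤n neutral at-p
      where
      neutral : ∀ {v} → p < v → v ≤ _ → Neutral cols f v
      neutral p<v _ = cols-one v≢1 (>⇒≢ p<v) , f-∷ v≢1 (>⇒≢ p<v)
        where v≢1 = >⇒≢ (<-trans 1<p p<v)

  aₚ≡cbar : ∀ n → a p (suc k) n ≡ cbar (suc k) p (ℤ.+ n ℤ.- ℤ.+ p ℤ.- ℤ.+ suc k ℤ.+ ℤ.+ 1)
  aₚ≡cbar n = begin
    a p (suc k) n
      ≡⟨ a≡weighted {k = suc k} f (λ xs → mult-pre-prime p-prime xs k) n ⟩
    weighted f n n
      ≡⟨ by-size ⟩
    countℤ cols (ℤ.+ n ℤ.- ℤ.+ (p + k))
      ≡⟨ cong (countℤ cols) (n-p-[1+k]+1≡n-[p+k] n p k) ⟨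
    cbar (suc k) p (ℤ.+ n ℤ.- ℤ.+ p ℤ.- ℤ.+ suc k ℤ.+ ℤ.+ 1)
      ∎
    where
    open ≡-Reasoning
    by-size : weighted f n n ≡ countℤ cols (ℤ.+ n ℤ.- ℤ.+ (p + k))
    by-size with p ≤? n
    ... | yes p≤n = trans (above-p p≤n n) (sym (countℤ-∸ cols n (p + k)))
    ... | no p≰n  = trans (below-p-vanishes (≰⇒> p≰n) n)
                          (sym (countℤ-negative cols (≤-trans (≰⇒> p≰n) (m≤m+n p k))))

theorem3p1 : (n k : ℕ) → 1 ≤ n → 1 ≤ k →
    (a 1 k n ≡ c (suc k) (ℤ.+ n ℤ.- ℤ.+ k))
    × ((p : ℕ) → Prime p → a p k n ≡ cbar k p (ℤ.+ n ℤ.- ℤ.+ p ℤ.- ℤ.+ k ℤ.+ ℤ.+ 1))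
theorem3p1 n (suc k) 1≤n _ = a₁≡c n (suc k) 1≤n , prime-case
  where
  prime-case : (p : ℕ) → Prime p →
               a p (suc k) n ≡ cbar (suc k) p (ℤ.+ n ℤ.- ℤ.+ p ℤ.- ℤ.+ suc k ℤ.+ ℤ.+ 1)
  prime-case zero    p-prime = contradiction (nonTrivial⇒n>1 0 {{prime⇒nonTrivial p-prime}}) λ ()
  prime-case (suc p) p-prime = aₚ≡cbar p-prime k n
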